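{- For any graph $H$, $\mathrm{edp}(\mathrm{Wall}[H])\geq\alpha(H)$.
   Context: Let $H$ have vertices $1,\ldots,n$. The directed acyclic graph $\mathrm{Wall}[H]$ is defined via a plane drawing: for each $i$, a polyline $\ell_i$ goes from $s_i=(0,i)$ horizontally right to $(n+1-i,i)$ and then vertically down to $t_i=(n+1-i,0)$, oriented from $s_i$ to $t_i$. For $i\neq j$, $\ell_i$ and $\ell_j$ cross at exactly one point $y_{i,j}$. If $ij\in E(H)$, the crossing is replaced by two vertices $x^{in}_{i,j},x^{out}_{i,j}$ with a directed edge $x^{in}_{i,j}x^{out}_{i,j}$, through which both lines pass (both incoming segments enter $x^{in}_{i,j}$, both outgoing segments leave $x^{out}_{i,j}$). If $ij\notin E(H)$, the crossing is an uncrossing: the two lines pass each other without sharing any vertex or edge. Edges of $\mathrm{Wall}[H]$ are the directed segments between consecutive vertices along each line (directed left-to-right and top-to-bottom). The instance has source-sink pairs $(s_i,t_i)$, $i=1,\dots,n$, and $\mathrm{edp}(\mathrm{Wall}[H])$ is the maximum number of these pairs that can be connected by pairwise edge-disjoint directed paths. $\alpha(H)$ is the independence number. -}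

module Defs where

open import Data.Nat using (ℕ; _≤_; _<ᵇ_)
open import Data.Bool using (Bool; true; false; if_then_else_)
open import Data.Fin using (Fin; toℕ)
open import Data.Fin.Subset using (Subset; _∈_; ∣_∣)
open import Data.List using (List; []; _∷_; _++_; concatMap; reverse; allFin)
open import Data.List.Membership.Propositional renaming (_∈_ to _∈L_; _∉_ to _∉L_)
open import Data.Product using (Σ; ∃; _×_; _,_)
open import Relation.Binary.PropositionalEquality using (_≡_; _≢_)

-- A (simple, undirected) graph on vertex set Fin n  (vertex k of Fin n is vertex k+1 of the paper).
record Graph (n : ℕ) : Set where
  field
    adj    : Fin n → Fin n → Bool
    sym    : ∀ i j → adj i j ≡ adj j i
    irrefl : ∀ i → adj i i ≡ false
open Graph public

Independent : ∀ {n} → Graph n → Subset n → Set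
Independent H S = ∀ i j → i ∈ S → j ∈ S → adj H i j ≡ false

IsIndependenceNumber : ∀ {n} → Graph n → ℕ → Set
IsIndependenceNumber {n} H a =
  (Σ (Subset n) λ S → Independent H S × ∣ S ∣ ≡ a) ×
  (∀ S → Independent H S → ∣ S ∣ ≤ a)

-- Vertices of Wall[H]: s_i, t_i and, for a crossing {i,j} that is an edge of H,
-- x^in_{i,j}, x^out_{i,j}; crossings are named canonically with the smaller index first.
data WV (n : ℕ) : Set where
  src  : Fin n → WV n
  snk  : Fin n → WV n
  xin  : Fin n → Fin n → WV n
  xout : Fin n → Fin n → WV n

cin : ∀ {n} → Fin n → Fin n → WV n
cin i j = if toℕ i <ᵇ toℕ j then xin i j else xin j i

cout : ∀ {n} → Fin n → Fin n → WV n
cout i j = if toℕ i <ᵇ toℕ j then xout i j else xout j i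

-- Along ℓ_i (paper indexing) the crossing
-- with ℓ_j is met in decreasing order of j (j = n, …, i+1 on the horizontal part at
-- x = n+1-j, then j = i-1, …, 1 on the vertical part at height j).
lineVerts : ∀ {n} → Graph n → Fin n → List (WV n)
lineVerts {n} H i =
  src i ∷ (concatMap (λ j → if adj H i j then cin i j ∷ cout i j ∷ [] else [])
                     (reverse (allFin n))
           ++ (snk i ∷ []))

data Consec {A : Set} (u v : A) : List A → Set where
  here  : ∀ {xs} → Consec u v (u ∷ v ∷ xs)
  there : ∀ {x xs} → Consec u v xs → Consec u v (x ∷ xs)

WallEdge : ∀ {n} → Graph n → WV n → WV n → Set
WallEdge {n} H u v = ∃ λ (i : Fin n) → Consec u v (lineVerts H i)

-- Directed walks (in the DAG Wall[H] every walk is a path).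
data Walk {n : ℕ} (H : Graph n) : WV n → WV n → Set where
  []  : ∀ {v} → Walk H v v
  _∷_ : ∀ {u v w} → WallEdge H u v → Walk H v w → Walk H u w

edges : ∀ {n} {H : Graph n} {u w} → Walk H u w → List (WV n × WV n)
edges [] = []
edges (_∷_ {u} {v} _ p) = (u , v) ∷ edges p

Routable : ∀ {n} → Graph n → Subset n → Set
Routable {n} H S =
  Σ ((i : Fin n) → i ∈ S → Walk H (src i) (snk i)) λ P →
    ∀ i j (i∈ : i ∈ S) (j∈ : j ∈ S) → i ≢ j →
      ∀ e → e ∈L edges (P i i∈) → e ∉L edges (P j j∈)

IsEdp : ∀ {n} → Graph n → ℕ → Set
IsEdp {n} H e =
  (Σ (Subset n) λ S → Routable H S × ∣ S ∣ ≡ e) ×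
  (∀ S → Routable H S → ∣ S ∣ ≤ e)

-- Route every vertex i of a maximum independent set along its own line ℓ_i.  Each edge of ℓ_i
-- leaves either s_i or one of the vertices x^in, x^out that replace a crossing of ℓ_i with a
-- line ℓ_k with ik ∈ E(H).  Such a vertex lies on ℓ_i and ℓ_k only, so two lines ℓ_i, ℓ_j
-- can share an edge only if ij ∈ E(H); the lines of an independent set are edge-disjoint.
module Submission where

open import Defs
open import Data.Nat using (ℕ; _≤_; _<ᵇ_)
open import Data.Bool using (true; false; if_then_else_)
open import Data.Fin using (Fin; toℕ)
open import Data.List using (List; []; _∷_; _++_; [_]; concatMap; reverse; allFin)
open import Data.List.Membership.Propositional renaming (_∈_ to _∈L_)
open import Data.List.Membership.Propositional.Properties using (∈-concatMap⁻)
open import Data.List.Relation.Unary.Any using (here; there; satisfied)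
open import Data.Product using (_,_; proj₁)
open import Data.Empty using (⊥; ⊥-elim)
open import Relation.Binary.PropositionalEquality as ≡ using (_≡_; _≢_; refl)

-- u is one of the two vertices replacing the crossing of ℓ_i and ℓ_k; both index orders occur
-- because crossings are named with the smaller index first.
data Crossing {n : ℕ} (i k : Fin n) : WV n → Set where
  xin-ik  : Crossing i k (xin i k)
  xin-ki  : Crossing i k (xin k i)
  xout-ik : Crossing i k (xout i k)
  xout-ki : Crossing i k (xout k i)

cin-crossing : ∀ {n} (i k : Fin n) → Crossing i k (cin i k)
cin-crossing i k with toℕ i <ᵇ toℕ k
... | true  = xin-ik
... | false = xin-ki

cout-crossing : ∀ {n} (i k : Fin n) → Crossing i k (cout i k)
cout-crossing i k with toℕ i <ᵇ toℕ k
... | true  = xout-ik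
... | false = xout-ki

crossing-partner : ∀ {n} {i j k l : Fin n} {u} → i ≢ j → Crossing i k u → Crossing j l u → k ≡ j
crossing-partner i≢j xin-ik  xin-ik  = ⊥-elim (i≢j refl)
crossing-partner i≢j xin-ik  xin-ki  = refl
crossing-partner i≢j xin-ki  xin-ik  = refl
crossing-partner i≢j xin-ki  xin-ki  = ⊥-elim (i≢j refl)
crossing-partner i≢j xout-ik xout-ik = ⊥-elim (i≢j refl)
crossing-partner i≢j xout-ik xout-ki = refl
crossing-partner i≢j xout-ki xout-ik = refl
crossing-partner i≢j xout-ki xout-ki = ⊥-elim (i≢j refl)

module _ {n : ℕ} (H : Graph n) where

  consecWalk : (x : WV n) (ms : List (WV n)) (y : WV n) →
               (∀ {u v} → Consec u v (x ∷ ms ++ [ y ]) → WallEdge H u v) → Walk H x y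
  consecWalk x []       y edge = edge here ∷ []
  consecWalk x (m ∷ ms) y edge = edge here ∷ consecWalk m ms y (λ c → edge (there c))

  consecWalk-tail : ∀ x ms y (edge : ∀ {u v} → Consec u v (x ∷ ms ++ [ y ]) → WallEdge H u v) →
                    ∀ e → e ∈L edges (consecWalk x ms y edge) → proj₁ e ∈L x ∷ ms
  consecWalk-tail x []       y edge e (here refl) = here refl
  consecWalk-tail x (m ∷ ms) y edge e (here refl) = here refl
  consecWalk-tail x (m ∷ ms) y edge e (there e∈) =
    there (consecWalk-tail m ms y (λ c → edge (there c)) e e∈)

  -- lineVerts H i is definitionally src i ∷ innerVerts i ++ [ snk i ].
  innerVerts : Fin n → List (WV n)
  innerVerts i =
    concatMap (λ k → if adj H i k then cin i k ∷ cout i k ∷ [] else []) (reverse (allFin n))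

  lineWalk : (i : Fin n) → Walk H (src i) (snk i)
  lineWalk i = consecWalk (src i) (innerVerts i) (snk i) (i ,_)

  data LineTail (i : Fin n) : WV n → Set where
    source   : LineTail i (src i)
    crossing : ∀ {k u} → adj H i k ≡ true → Crossing i k u → LineTail i u

  crossingVerts-tail : ∀ i k {u} →
                       u ∈L (if adj H i k then cin i k ∷ cout i k ∷ [] else []) → LineTail i u
  crossingVerts-tail i k u∈ with adj H i k in ik∈E
  crossingVerts-tail i k (here refl)         | true = crossing ik∈E (cin-crossing i k)
  crossingVerts-tail i k (there (here refl)) | true = crossing ik∈E (cout-crossing i k)

  lineTail : ∀ i {u} → u ∈L src i ∷ innerVerts i → LineTail i u
  lineTail i (here refl) = source
  lineTail i (there u∈)  =
    let k , u∈k = satisfied (∈-concatMap⁻ _ {reverse (allFin n)} u∈) in crossingVerts-tail i k u∈k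

  lineWalk-tail : ∀ i e → e ∈L edges (lineWalk i) → LineTail i (proj₁ e)
  lineWalk-tail i e e∈ = lineTail i (consecWalk-tail (src i) (innerVerts i) (snk i) (i ,_) e e∈)

  lineTails-disjoint : ∀ {i j u} → i ≢ j → adj H i j ≡ false → LineTail i u → LineTail j u → ⊥
  lineTails-disjoint i≢j ij∉E source            source         = i≢j refl
  lineTails-disjoint i≢j ij∉E (crossing ik∈E c) (crossing _ d) with crossing-partner i≢j c d
  ... | refl with ≡.trans (≡.sym ik∈E) ij∉E
  ... | ()

  independent⇒routable : ∀ S → Independent H S → Routable H S
  independent⇒routable S indep =
    (λ i _ → lineWalk i) ,
    λ i j i∈S j∈S i≢j e e∈ᵢ e∈ⱼ →
      lineTails-disjoint i≢j (indep i j i∈S j∈S) (lineWalk-tail i e e∈ᵢ) (lineWalk-tail j e e∈ⱼ)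

lemma6p1 : ∀ {n} (H : Graph n) (a e : ℕ) → IsIndependenceNumber H a → IsEdp H e → a ≤ e
lemma6p1 H a e ((S , indep , refl) , _) (_ , maximal) = maximal S (independent⇒routable H S indep)
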